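{- Let $n>2$ students sit in a circle and let $c \geq 3n-2$ candies be distributed arbitrarily among them, and play the candy-passing game described in the context. Then all students' candy piles eventually stabilize: there is a round after which the number of candies held by each student never changes again.
   Context: The candy-passing game: $c>0$ candies are distributed arbitrarily among $n>2$ students sitting in a circle. At each round (each sounding of a whistle), simultaneously, every student who has two or more candies passes one candy to his left-hand neighbor and one candy to his right-hand neighbor; a student with fewer than two candies does nothing. A student's candy pile is said to have stabilized after some round if the amount of candy that student has does not change over the remainder of the game. -}

module Defs where

open import Data.Nat using (ℕ; zero; suc; _+_; _*_; _∸_; _≤_; _≥_; _≤ᵇ_)
open import Data.Nat.DivMod using (_mod_)
open import Data.Fin using (Fin; toℕ)
open import Data.List using (map; allFin)
open import Data.Nat.ListAction using (sum)
open import Data.Bool using (if_then_else_)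

-- Student (i+1 mod n) is the
-- left-hand neighbour of i and student (i-1 mod n) = (i + (n-1) mod n)
-- is the right-hand neighbour (the orientation is irrelevant by symmetry).
Config : ℕ → Set
Config n = Fin n → ℕ

total : (n : ℕ) → Config n → ℕ
total n a = sum (map a (allFin n))

gives : ℕ → ℕ
gives k = if 2 ≤ᵇ k then 1 else 0

next : (m : ℕ) → Fin (suc m) → Fin (suc m)
next m i = (suc (toℕ i)) mod (suc m)

prev : (m : ℕ) → Fin (suc m) → Fin (suc m)
prev m i = (toℕ i + m) mod (suc m)

step : (m : ℕ) → Config (suc m) → Config (suc m)
step m a i = (a i ∸ 2 * gives (a i)) + gives (a (prev m i)) + gives (a (next m i))

play : (m : ℕ) → ℕ → Config (suc m) → Config (suc m)
play m zero    a = a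
play m (suc t) a = step m (play m t a)

-- A pile of at most three candies stays at most three, so a student holding at least four
-- candies at round L held at least four, and hence fired, in every earlier round.  Counting
-- firings f_t(v) up to round t,
--   x_t(v) + 2 f_t(v) = a(v) + f_t(v−1) + f_t(v+1),
-- so the lag L − f_L of a neighbour is at most twice one's own lag plus the total c; going once
-- around the circle, every student has fired in all but a bounded number B of the first L rounds.
-- As long as no round finds every student with at least two candies (after such a round nothing
-- changes any more), every round leaves some student idle, which is impossible once L > n·B.
-- So at round L = n·B + 1 no pile exceeds three; the deficits below three then sum to at most 2
-- because c ≥ 3n − 2, and one more round gives every student at least two candies.

module Submission where

open import Data.Fin using (Fin; zero; suc; toℕ; inject₁; fromℕ; punchIn; punchOut)
open import Data.Fin.Properties
  using (toℕ-injective; toℕ-inject₁; toℕ-fromℕ; toℕ-fromℕ<; toℕ<n; punchIn-punchOut; all?; any?; ¬∀⟶∃¬)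
open import Data.List using (_∷_; []; tabulate)
open import Data.List.Properties using (map-tabulate)
open import Data.Nat using (ℕ; zero; suc; _+_; _*_; _∸_; _≤_; _<_; _>_; z≤n; s≤s; _≤?_)
open import Data.Nat.DivMod using (_%_; m<n⇒m%n≡m; m≤n⇒m%n≡m; n%n≡0; [m+n]%n≡m%n)
import Data.Nat.ListAction as ListAction using (sum)
open import Data.Nat.Properties
open import Algebra.Properties.CommutativeMonoid.Sum +-0-commutativeMonoid
  using (sum; sum-cong-≗; ∑-distrib-+; sum-remove; sum-init-last)
open import Data.Nat.Tactic.RingSolver using (solve; solve-∀)
open import Data.Product using (∃; _,_)
open import Data.Sum using (_⊎_; inj₁; inj₂)
open import Data.Vec.Functional using (removeAt)
open import Function using (_∘_; id)
open import Relation.Binary.PropositionalEquality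
open import Relation.Nullary using (¬_; contradiction; yes; no)

open import Defs

private variable
  k p q n m : ℕ

-- Finite sums

total≡sum : ∀ n (a : Config n) → total n a ≡ sum a
total≡sum n a = trans (cong ListAction.sum (map-tabulate id a)) (sum-tabulate n a)
  where
  sum-tabulate : ∀ n (f : Fin n → ℕ) → ListAction.sum (tabulate f) ≡ sum f
  sum-tabulate zero    f = refl
  sum-tabulate (suc n) f = cong (f zero +_) (sum-tabulate n (f ∘ suc))

sum-const : ∀ n c → sum {n} (λ _ → c) ≡ n * c
sum-const zero    c = refl
sum-const (suc n) c = cong (c +_) (sum-const n c)

sum-mono-≤ : {f g : Fin n → ℕ} → (∀ i → f i ≤ g i) → sum f ≤ sum g
sum-mono-≤ {zero}  f≤g = z≤n
sum-mono-≤ {suc n} f≤g = +-mono-≤ (f≤g zero) (sum-mono-≤ (f≤g ∘ suc))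

f[i]≤sum : (f : Fin n → ℕ) (i : Fin n) → f i ≤ sum f
f[i]≤sum {suc n} f i = ≤-trans (m≤m+n (f i) _) (≤-reflexive (sym (sum-remove f)))

f[i]+f[j]≤sum : (f : Fin n → ℕ) {i j : Fin n} → i ≢ j → f i + f j ≤ sum f
f[i]+f[j]≤sum {suc n} f {i} {j} i≢j = begin
  f i + f j                              ≡⟨ cong (λ k → f i + f k) (punchIn-punchOut i≢j) ⟨
  f i + removeAt f i (punchOut i≢j)      ≤⟨ +-monoʳ-≤ (f i) (f[i]≤sum (removeAt f i) (punchOut i≢j)) ⟩
  f i + sum (removeAt f i)               ≡⟨ sum-remove f ⟨
  sum f                                  ∎
  where open ≤-Reasoning

sum<n : (f : Fin n → ℕ) → (∀ i → f i ≤ 1) → ∀ w → f w ≡ 0 → sum f < n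
sum<n {suc n} f f≤1 w fw≡0 = s≤s (begin
  sum f                     ≡⟨ sum-remove {i = w} f ⟩
  f w + sum (removeAt f w)  ≡⟨ cong (_+ sum (removeAt f w)) fw≡0 ⟩
  sum (removeAt f w)        ≤⟨ sum-mono-≤ (f≤1 ∘ punchIn w) ⟩
  sum {n} (λ _ → 1)         ≡⟨ trans (sum-const n 1) (*-identityʳ n) ⟩
  n                         ∎)
  where open ≤-Reasoning

sum-*ˡ : ∀ c (f : Fin n → ℕ) → sum (λ i → c * f i) ≡ c * sum f
sum-*ˡ {zero}  c f = sym (*-zeroʳ c)
sum-*ˡ {suc n} c f = trans (cong (c * f zero +_) (sum-*ˡ c (f ∘ suc))) (sym (*-distribˡ-+ c (f zero) _))

-- Neighbours on the circle

toℕ-next-< : (i : Fin (suc m)) → toℕ i < m → toℕ (next m i) ≡ suc (toℕ i)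
toℕ-next-< i i<m = trans (toℕ-fromℕ< _) (m<n⇒m%n≡m (s≤s i<m))

toℕ-next-last : (i : Fin (suc m)) → toℕ i ≡ m → toℕ (next m i) ≡ 0
toℕ-next-last {m} i i≡m = trans (toℕ-fromℕ< _) (trans (cong (λ k → suc k % suc m) i≡m) (n%n≡0 (suc m)))

toℕ-prev-zero : toℕ (prev m zero) ≡ m
toℕ-prev-zero = trans (toℕ-fromℕ< _) (m≤n⇒m%n≡m ≤-refl)

toℕ-prev-suc : (i : Fin m) → toℕ (prev m (suc i)) ≡ toℕ i
toℕ-prev-suc {m} i = begin
  toℕ (prev m (suc i))       ≡⟨ toℕ-fromℕ< _ ⟩
  (suc (toℕ i) + m) % suc m  ≡⟨ cong (_% suc m) (+-suc (toℕ i) m) ⟨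
  (toℕ i + suc m) % suc m    ≡⟨ [m+n]%n≡m%n (toℕ i) (suc m) ⟩
  toℕ i % suc m              ≡⟨ m<n⇒m%n≡m (m≤n⇒m≤1+n (toℕ<n i)) ⟩
  toℕ i                      ∎
  where open ≡-Reasoning

next-inject₁ : (i : Fin m) → next m (inject₁ i) ≡ suc i
next-inject₁ {m} i = toℕ-injective (begin
  toℕ (next m (inject₁ i))   ≡⟨ toℕ-next-< (inject₁ i) (subst (_< m) (sym (toℕ-inject₁ i)) (toℕ<n i)) ⟩
  suc (toℕ (inject₁ i))      ≡⟨ cong suc (toℕ-inject₁ i) ⟩
  suc (toℕ i)                ∎)
  where open ≡-Reasoning

next-fromℕ : next m (fromℕ m) ≡ zero
next-fromℕ {m} = toℕ-injective (toℕ-next-last (fromℕ m) (toℕ-fromℕ m))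

prev-suc : (i : Fin m) → prev m (suc i) ≡ inject₁ i
prev-suc i = toℕ-injective (trans (toℕ-prev-suc i) (sym (toℕ-inject₁ i)))

prev-zero : prev m zero ≡ fromℕ m
prev-zero {m} = toℕ-injective (trans toℕ-prev-zero (sym (toℕ-fromℕ m)))

sum-∘next : (g : Fin (suc m) → ℕ) → sum (g ∘ next m) ≡ sum g
sum-∘next {m} g = begin
  sum (g ∘ next m)                          ≡⟨ sum-init-last (g ∘ next m) ⟩
  sum (g ∘ next m ∘ inject₁) + g (next m (fromℕ m))
                                            ≡⟨ cong₂ _+_ (sum-cong-≗ (cong g ∘ next-inject₁)) (cong g next-fromℕ) ⟩
  sum (g ∘ suc) + g zero                    ≡⟨ +-comm (sum (g ∘ suc)) (g zero) ⟩
  sum g                                     ∎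
  where open ≡-Reasoning

sum-∘prev : (g : Fin (suc m) → ℕ) → sum (g ∘ prev m) ≡ sum g
sum-∘prev {m} g = begin
  g (prev m zero) + sum (g ∘ prev m ∘ suc)  ≡⟨ cong₂ _+_ (cong g prev-zero) (sum-cong-≗ (cong g ∘ prev-suc)) ⟩
  g (fromℕ m) + sum (g ∘ inject₁)           ≡⟨ +-comm (g (fromℕ m)) _ ⟩
  sum (g ∘ inject₁) + g (fromℕ m)           ≡⟨ sum-init-last g ⟨
  sum g                                     ∎
  where open ≡-Reasoning

next≢ : 1 ≤ m → (i : Fin (suc m)) → next m i ≢ i
next≢ {m} 1≤m i next≡i with m≤n⇒m<n∨m≡n (≤-pred (toℕ<n i))
... | inj₁ i<m = 1+n≢n (trans (sym (toℕ-next-< i i<m)) (cong toℕ next≡i))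
... | inj₂ i≡m = <⇒≢ 1≤m (trans (sym (toℕ-next-last i i≡m)) (trans (cong toℕ next≡i) i≡m))

prev≢ : 1 ≤ m → (i : Fin (suc m)) → prev m i ≢ i
prev≢ 1≤m zero    prev≡i = <⇒≢ 1≤m (sym (trans (sym toℕ-prev-zero) (cong toℕ prev≡i)))
prev≢ 1≤m (suc i) prev≡i = 1+n≢n (sym (trans (sym (toℕ-prev-suc i)) (cong toℕ prev≡i)))

prev≢next : 2 ≤ m → (i : Fin (suc m)) → prev m i ≢ next m i
prev≢next {m} 2≤m zero prev≡next = <⇒≢ 2≤m (sym (begin
  m                       ≡⟨ toℕ-prev-zero ⟨
  toℕ (prev m zero)       ≡⟨ cong toℕ prev≡next ⟩
  toℕ (next m zero)       ≡⟨ toℕ-next-< zero (≤-trans (s≤s z≤n) 2≤m) ⟩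
  1                       ∎))
  where open ≡-Reasoning
prev≢next {m} 2≤m (suc i) prev≡next with m≤n⇒m<n∨m≡n (≤-pred (toℕ<n (suc i)))
... | inj₁ i<m = <⇒≢ (m<n⇒m<1+n (n<1+n (toℕ i)))
  (trans (sym (toℕ-prev-suc i)) (trans (cong toℕ prev≡next) (toℕ-next-< (suc i) i<m)))
... | inj₂ i≡m = <⇒≢ 2≤m (sym (trans (sym i≡m) (cong suc i≡0)))
  where
  i≡0 : toℕ i ≡ 0
  i≡0 = trans (sym (toℕ-prev-suc i)) (trans (cong toℕ prev≡next) (toℕ-next-last (suc i) i≡m))

-- One student's round

update : ℕ → ℕ → ℕ → ℕ
update k p q = (k ∸ 2 * gives k) + gives p + gives q

deficit : ℕ → ℕ
deficit k = 3 ∸ k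

gives≤1 : ∀ k → gives k ≤ 1
gives≤1 0             = z≤n
gives≤1 1             = z≤n
gives≤1 (suc (suc k)) = ≤-refl

gives-rich : 2 ≤ k → gives k ≡ 1
gives-rich (s≤s (s≤s _)) = refl

gives-poor : ¬ 2 ≤ k → gives k ≡ 0
gives-poor {0}           _   = refl
gives-poor {1}           _   = refl
gives-poor {suc (suc k)} k≱2 = contradiction (s≤s (s≤s z≤n)) k≱2

update-balance : ∀ k p q → update k p q + 2 * gives k ≡ k + gives p + gives q
update-balance 0             p q = +-identityʳ _
update-balance 1             p q = +-identityʳ _
update-balance (suc (suc k)) p q = +-comm (k + gives p + gives q) 2

update-fixed : 2 ≤ k → 2 ≤ p → 2 ≤ q → update k p q ≡ k
update-fixed {suc (suc k)} (s≤s (s≤s _)) 2≤p 2≤q rewrite gives-rich 2≤p | gives-rich 2≤q =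
  trans (+-assoc k 1 1) (+-comm k 2)

update≤3 : ∀ k p q → k ≤ 3 → update k p q ≤ 3
update≤3 0 p q _ = m≤n⇒m≤1+n (+-mono-≤ (gives≤1 p) (gives≤1 q))
update≤3 1 p q _ = s≤s (+-mono-≤ (gives≤1 p) (gives≤1 q))
update≤3 2 p q _ = m≤n⇒m≤1+n (+-mono-≤ (gives≤1 p) (gives≤1 q))
update≤3 3 p q _ = s≤s (+-mono-≤ (gives≤1 p) (gives≤1 q))
update≤3 (suc (suc (suc (suc k)))) p q (s≤s (s≤s (s≤s ())))

4≤update⇒4≤ : ∀ k p q → 4 ≤ update k p q → 4 ≤ k
4≤update⇒4≤ k p q 4≤u with k ≤? 3
... | yes k≤3 = contradiction 4≤u (≤⇒≯ (update≤3 k p q k≤3))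
... | no  k≰3 = ≰⇒> k≰3

deficit≤1⇒gives≡1 : deficit k ≤ 1 → gives k ≡ 1
deficit≤1⇒gives≡1 {0}           (s≤s ())
deficit≤1⇒gives≡1 {1}           (s≤s ())
deficit≤1⇒gives≡1 {suc (suc k)} _ = refl

2≤update : ∀ k p q → deficit k + deficit p ≤ 2 → deficit k + deficit q ≤ 2 →
           deficit p + deficit q ≤ 2 → 2 ≤ update k p q
2≤update 0 p q (s≤s (s≤s ())) _ _
2≤update 1 p q (s≤s (s≤s dp≤0)) (s≤s (s≤s dq≤0)) _
  rewrite deficit≤1⇒gives≡1 {p} (≤-trans dp≤0 z≤n) = s≤s (s≤s z≤n)
2≤update 2 p q (s≤s dp≤1) (s≤s dq≤1) _
  rewrite deficit≤1⇒gives≡1 {p} dp≤1 | deficit≤1⇒gives≡1 {q} dq≤1 = ≤-refl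
2≤update 3 0 q _ _ (s≤s (s≤s ()))
2≤update 3 1 q _ _ (s≤s (s≤s dq≤0)) rewrite deficit≤1⇒gives≡1 {q} (≤-trans dq≤0 z≤n) = ≤-refl
2≤update 3 (suc (suc p)) q _ _ _ = s≤s (s≤s z≤n)
2≤update (suc (suc (suc (suc k)))) p q _ _ _ = s≤s (s≤s z≤n)

-- Configurations in which every student passes

Rich : Config n → Set
Rich y = ∀ v → 2 ≤ y v

rich-after-step : 2 ≤ m → (y : Config (suc m)) → (∀ v → y v ≤ 3) → 3 * suc m ∸ 2 ≤ sum y →
                  Rich (step m y)
rich-after-step {m} 2≤m y y≤3 c≥ v =
  2≤update (y v) (y (prev m v)) (y (next m v))
    (≤-trans (f[i]+f[j]≤sum d (prev≢ 1≤m v ∘ sym)) ∑d≤2)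
    (≤-trans (f[i]+f[j]≤sum d (next≢ 1≤m v ∘ sym)) ∑d≤2)
    (≤-trans (f[i]+f[j]≤sum d (prev≢next 2≤m v)) ∑d≤2)
  where
  1≤m : 1 ≤ m
  1≤m = ≤-trans (s≤s z≤n) 2≤m
  d : Fin (suc m) → ℕ
  d = deficit ∘ y
  ∑d≤2 : sum d ≤ 2
  ∑d≤2 = +-cancelˡ-≤ (sum y) _ _ (begin
    sum y + sum d              ≡⟨ ∑-distrib-+ y d ⟨
    sum (λ w → y w + d w)      ≡⟨ sum-cong-≗ (λ w → m+[n∸m]≡n (y≤3 w)) ⟩
    sum {suc m} (λ _ → 3)      ≡⟨ trans (sum-const (suc m) 3) (*-comm (suc m) 3) ⟩
    3 * suc m                  ≤⟨ m≤n+m∸n (3 * suc m) 2 ⟩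
    2 + (3 * suc m ∸ 2)        ≤⟨ +-monoʳ-≤ 2 c≥ ⟩
    2 + sum y                  ≡⟨ +-comm 2 (sum y) ⟩
    sum y + 2                  ∎)
    where open ≤-Reasoning

play-+ : ∀ d t (y : Config (suc m)) → play m (d + t) y ≡ play m d (play m t y)
play-+ zero    t y = refl
play-+ (suc d) t y = cong (step _) (play-+ d t y)

play-fixed : (y : Config (suc m)) → Rich y → ∀ d v → play m d y v ≡ y v
play-fixed y rich zero    v = refl
play-fixed {m} y rich (suc d) v
  rewrite play-fixed y rich d v | play-fixed y rich d (prev m v) | play-fixed y rich d (next m v) =
  update-fixed (rich v) (rich (prev m v)) (rich (next m v))

-- The game from a fixed start

module Game (m : ℕ) (a : Config (suc m)) where

  N : ℕ
  N = suc m

  conf : ℕ → Config N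
  conf t = play m t a

  fired : Fin N → ℕ → ℕ
  fired v zero    = 0
  fired v (suc t) = fired v t + gives (conf t v)

  fired≤ : ∀ v t → fired v t ≤ t
  fired≤ v zero    = z≤n
  fired≤ v (suc t) = ≤-trans (+-mono-≤ (fired≤ v t) (gives≤1 (conf t v))) (≤-reflexive (+-comm t 1))

  firing-balance : ∀ t v → conf t v + 2 * fired v t ≡ a v + fired (prev m v) t + fired (next m v) t
  firing-balance zero    v = sym (+-identityʳ _)
  firing-balance (suc t) v =
    accumulate {x′ = conf (suc t) v} {F = fired v t} {Fp = fired (prev m v) t} {Fn = fired (next m v) t}
      (update-balance (conf t v) (conf t (prev m v)) (conf t (next m v))) (firing-balance t v)
    where
    accumulate : ∀ {x′ g x gp gn F A Fp Fn} → x′ + 2 * g ≡ x + gp + gn → x + 2 * F ≡ A + Fp + Fn →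
                 x′ + 2 * (F + g) ≡ A + (Fp + gp) + (Fn + gn)
    accumulate {x′} {g} {x} {gp} {gn} {F} {A} {Fp} {Fn} round sofar = begin
      x′ + 2 * (F + g)          ≡⟨ solve (x′ ∷ F ∷ g ∷ []) ⟩
      (x′ + 2 * g) + 2 * F      ≡⟨ cong (_+ 2 * F) round ⟩
      (x + gp + gn) + 2 * F     ≡⟨ solve (x ∷ gp ∷ gn ∷ F ∷ []) ⟩
      (x + 2 * F) + gp + gn     ≡⟨ cong (λ z → z + gp + gn) sofar ⟩
      A + Fp + Fn + gp + gn     ≡⟨ solve (A ∷ Fp ∷ Fn ∷ gp ∷ gn ∷ []) ⟩
      A + (Fp + gp) + (Fn + gn) ∎
      where open ≡-Reasoning

  totalFired : ℕ → ℕ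
  totalFired t = sum (λ v → fired v t)

  conservation : ∀ t → sum (conf t) ≡ sum a
  conservation t = +-cancelʳ-≡ (2 * totalFired t) _ _ (begin
    sum (conf t) + 2 * totalFired t                       ≡⟨ cong (sum (conf t) +_) (sum-*ˡ 2 F) ⟨
    sum (conf t) + sum (λ v → 2 * F v)                    ≡⟨ ∑-distrib-+ (conf t) (λ v → 2 * F v) ⟨
    sum (λ v → conf t v + 2 * F v)                        ≡⟨ sum-cong-≗ (firing-balance t) ⟩
    sum (λ v → a v + F (prev m v) + F (next m v))         ≡⟨ ∑-distrib-+ (λ v → a v + F (prev m v)) (F ∘ next m) ⟩
    sum (λ v → a v + F (prev m v)) + sum (F ∘ next m)     ≡⟨ cong₂ _+_ (∑-distrib-+ a (F ∘ prev m)) (sum-∘next F) ⟩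
    sum a + sum (F ∘ prev m) + totalFired t               ≡⟨ cong (λ s → sum a + s + totalFired t) (sum-∘prev F) ⟩
    sum a + totalFired t + totalFired t                   ≡⟨ +-assoc (sum a) _ _ ⟩
    sum a + (totalFired t + totalFired t)                 ≡⟨ cong (λ s → sum a + (totalFired t + s)) (+-identityʳ _) ⟨
    sum a + 2 * totalFired t                              ∎)
    where
    open ≡-Reasoning
    F : Fin N → ℕ
    F v = fired v t

  rich-or-idle : ∀ t → ∃ (Rich ∘ conf) ⊎ totalFired t + t ≤ N * t
  rich-or-idle zero = inj₂ (≤-reflexive (trans (+-identityʳ _) (sum-const N 0)))
  rich-or-idle (suc t) with rich-or-idle t | all? (λ v → 2 ≤? conf t v)
  ... | inj₁ rich | _        = inj₁ rich
  ... | inj₂ _    | yes rich = inj₁ (t , rich)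
  ... | inj₂ idle | no ¬rich with ¬∀⟶∃¬ N _ (λ v → 2 ≤? conf t v) ¬rich
  ...   | w , ¬2≤w = inj₂ (begin
    totalFired (suc t) + suc t                       ≡⟨ cong (_+ suc t) (∑-distrib-+ (λ v → fired v t) G) ⟩
    totalFired t + sum G + suc t                     ≡⟨ regroup (totalFired t) (sum G) t ⟩
    (totalFired t + t) + suc (sum G)                 ≤⟨ +-mono-≤ idle (sum<n G (gives≤1 ∘ conf t) w (gives-poor ¬2≤w)) ⟩
    N * t + N                                        ≡⟨ trans (+-comm (N * t) N) (sym (*-suc N t)) ⟩
    N * suc t                                        ∎)
    where
    open ≤-Reasoning
    G : Fin N → ℕ
    G v = gives (conf t v)
    regroup : ∀ A B t → A + B + suc t ≡ (A + t) + suc B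
    regroup = solve-∀

  always-fired : ∀ t h → 4 ≤ conf t h → fired h t ≡ t
  always-fired zero    h _   = refl
  always-fired (suc t) h 4≤ = begin
    fired h t + gives (conf t h)  ≡⟨ cong₂ _+_ (always-fired t h 4≤′) (gives-rich (≤-trans (s≤s (s≤s z≤n)) 4≤′)) ⟩
    t + 1                         ≡⟨ +-comm t 1 ⟩
    suc t                         ∎
    where
    open ≡-Reasoning
    4≤′ : 4 ≤ conf t h
    4≤′ = 4≤update⇒4≤ (conf t h) (conf t (prev m h)) (conf t (next m h)) 4≤

  lagBound : ℕ → ℕ
  lagBound zero    = 0
  lagBound (suc k) = sum a + 2 * lagBound k

  lagBound-mono : ∀ {k k′} → k ≤ k′ → lagBound k ≤ lagBound k′
  lagBound-mono z≤n       = z≤n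
  lagBound-mono (s≤s k≤k′) = +-monoʳ-≤ (sum a) (*-monoʳ-≤ 2 (lagBound-mono k≤k′))

  module Lag (L : ℕ) where

    Busy : ℕ → Fin N → Set
    Busy k u = L ≤ fired u L + lagBound k

    busy-mono : ∀ {k k′ u} → k ≤ k′ → Busy k u → Busy k′ u
    busy-mono k≤k′ busy = ≤-trans busy (+-monoʳ-≤ _ (lagBound-mono k≤k′))

    busy-next : ∀ k u → Busy k u → Busy (suc k) (next m u)
    busy-next k u busy =
      doubling {Fu = fired u L} {B = lagBound k} {X = conf L u} {Fn = fired (next m u) L}
        busy (firing-balance L u) (f[i]≤sum a u) (fired≤ (prev m u) L)
      where
      doubling : ∀ {L Fu B X A Fp Fn C} → L ≤ Fu + B → X + 2 * Fu ≡ A + Fp + Fn → A ≤ C → Fp ≤ L →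
                 L ≤ Fn + (C + 2 * B)
      doubling {L} {Fu} {B} {X} {A} {Fp} {Fn} {C} L≤Fu+B balance A≤C Fp≤L = +-cancelˡ-≤ L _ _ (begin
        L + L                      ≤⟨ +-mono-≤ L≤Fu+B L≤Fu+B ⟩
        (Fu + B) + (Fu + B)        ≡⟨ solve (Fu ∷ B ∷ []) ⟩
        2 * Fu + 2 * B             ≤⟨ +-monoˡ-≤ (2 * B) (m≤n+m (2 * Fu) X) ⟩
        X + 2 * Fu + 2 * B         ≡⟨ cong (_+ 2 * B) balance ⟩
        A + Fp + Fn + 2 * B        ≤⟨ +-monoˡ-≤ (2 * B) (+-monoˡ-≤ Fn (+-mono-≤ A≤C Fp≤L)) ⟩
        C + L + Fn + 2 * B         ≡⟨ solve (C ∷ L ∷ Fn ∷ B ∷ []) ⟩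
        L + (Fn + (C + 2 * B))     ∎)
        where open ≤-Reasoning

    busy-walk : ∀ d k u v → toℕ v ≡ toℕ u + d → Busy k u → Busy (k + d) v
    busy-walk zero k u v v≡u busy =
      subst₂ Busy (sym (+-identityʳ k)) (toℕ-injective (sym (trans v≡u (+-identityʳ _)))) busy
    busy-walk (suc d) k u v v≡u+d busy =
      subst (λ j → Busy j v) (sym (+-suc k d)) (busy-walk d (suc k) (next m u) v v≡next+d (busy-next k u busy))
      where
      u<m : toℕ u < m
      u<m = begin-strict
        toℕ u          <⟨ s≤s (m≤m+n (toℕ u) d) ⟩
        suc (toℕ u + d) ≡⟨ trans v≡u+d (+-suc (toℕ u) d) ⟨
        toℕ v          ≤⟨ ≤-pred (toℕ<n v) ⟩
        m              ∎
        where open ≤-Reasoning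
      v≡next+d : toℕ v ≡ toℕ (next m u) + d
      v≡next+d = trans v≡u+d (trans (+-suc (toℕ u) d) (cong (_+ d) (sym (toℕ-next-< u u<m))))

    busy-everywhere : ∀ h → Busy 0 h → ∀ v → Busy (N + N) v
    busy-everywhere h busy v = busy-mono distance (busy-walk (toℕ v) (suc d) zero v refl busy-zero)
      where
      d : ℕ
      d = m ∸ toℕ h
      busy-last : Busy d (fromℕ m)
      busy-last = busy-walk d 0 h (fromℕ m) (trans (toℕ-fromℕ m) (sym (m+[n∸m]≡n (≤-pred (toℕ<n h))))) busy
      busy-zero : Busy (suc d) zero
      busy-zero = subst (Busy (suc d)) next-fromℕ (busy-next d (fromℕ m) busy-last)
      distance : suc d + toℕ v ≤ N + N
      distance = +-mono-≤ (s≤s (m∸n≤m m (toℕ h))) (≤-pred (m≤n⇒m≤1+n (toℕ<n v)))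

  idle-bound : ∀ L h → fired h L ≡ L → totalFired L + L ≤ N * L → L ≤ N * lagBound (N + N)
  idle-bound L h always idle = +-cancelˡ-≤ (totalFired L) _ _ (begin
    totalFired L + L                    ≤⟨ idle ⟩
    N * L                               ≡⟨ sum-const N L ⟨
    sum {N} (λ _ → L)                   ≤⟨ sum-mono-≤ (busy-everywhere h busy-h) ⟩
    sum (λ v → fired v L + B)           ≡⟨ ∑-distrib-+ (λ v → fired v L) (λ _ → B) ⟩
    totalFired L + sum {N} (λ _ → B)    ≡⟨ cong (totalFired L +_) (sum-const N B) ⟩
    totalFired L + N * B                ∎)
    where
    open ≤-Reasoning
    open Lag L
    B : ℕ
    B = lagBound (N + N)
    busy-h : Busy 0 h
    busy-h = ≤-reflexive (sym (trans (+-identityʳ _) always))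

  horizon : ℕ
  horizon = suc (N * lagBound (N + N))

  eventually-rich : 2 ≤ m → 3 * N ∸ 2 ≤ sum a → ∃ (Rich ∘ conf)
  eventually-rich 2≤m c≥ with rich-or-idle horizon | any? (λ v → 4 ≤? conf horizon v)
  ... | inj₁ rich | _            = rich
  ... | inj₂ idle | yes (h , 4≤) = contradiction (idle-bound horizon h (always-fired horizon h 4≤) idle) (n≮n _)
  ... | inj₂ _    | no  none     =
    suc horizon ,
    rich-after-step 2≤m (conf horizon) (λ v → ≤-pred (≰⇒> (λ 4≤ → none (v , 4≤))))
      (subst (3 * N ∸ 2 ≤_) (sym (conservation horizon)) c≥)

theorem1 : (m : ℕ) → suc m > 2 → (a : Config (suc m)) →
    3 * suc m ∸ 2 ≤ total (suc m) a →
    ∃ λ T → (t : ℕ) → T ≤ t → (i : Fin (suc m)) →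
      play m t a i ≡ play m T a i
theorem1 m 2<N a c≥
  with Game.eventually-rich m a (≤-pred 2<N) (subst (3 * suc m ∸ 2 ≤_) (total≡sum (suc m) a) c≥)
... | s , rich = s , λ t s≤t i → begin
  play m t a i                  ≡⟨ cong (λ t → play m t a i) (m∸n+n≡m s≤t) ⟨
  play m (t ∸ s + s) a i        ≡⟨ cong (λ y → y i) (play-+ (t ∸ s) s a) ⟩
  play m (t ∸ s) (play m s a) i ≡⟨ play-fixed (play m s a) rich (t ∸ s) i ⟩
  play m s a i                  ∎
  where open ≡-Reasoning
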